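{- We have $\varphi_1(x_1)=1-x_1$, $\varphi_2(x_1,x_2)=1-x_2-x_1x_2$, and for every $r\ge 3$, \[ \varphi_r(x_1,\ldots,x_r)=\left(1-x_1x_r+x_r\frac{\partial}{\partial x_{r-1}}\right)\varphi_{r-2}(x_2,\ldots,x_{r-1}), \] where $\varphi_{r-2}(x_2,\ldots,x_{r-1})$ denotes $\varphi_{r-2}$ evaluated with its $r-2$ variables set to $x_2,\ldots,x_{r-1}$.
   Context: An odd composition is a finite sequence of odd positive integers; $\mathrm{OC}_{\le r}$ is the set of odd compositions of integers in $\{0,1,\ldots,r\}$ (including the empty composition). For $\alpha=(\alpha_1,\ldots,\alpha_\ell)$, $\ell(\alpha)=\ell$ is its number of parts. For a positive integer $r$ define the permutation $\sigma_r$ of $\{1,\ldots,r\}$ by $\sigma_r(i)=i/2$ if $i$ is even and $\sigma_r(i)=r+(1-i)/2$ if $i$ is odd. Define \[ \varphi_r(x_1,\ldots,x_r)=\sum_{\alpha\in\mathrm{OC}_{\le r}}(-1)^{\lfloor(\ell(\alpha)+1)/2\rfloor}x_\alpha,\qquad x_\alpha=\prod_{i=1}^{\ell(\alpha)}x_{\sigma_r(\alpha_1+\cdots+\alpha_i)}. \] -}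

module Defs where

open import Data.Nat as ℕ using (ℕ; zero; suc; _∸_; _≤ᵇ_)
open import Data.Nat.DivMod using (_/_; _%_)
open import Data.Integer as ℤ using (ℤ; +_; -_; -1ℤ)
open import Data.Fin using (Fin; toℕ)
open import Data.Vec as Vec using (Vec; []; _∷_; _∷ʳ_; zipWith; replicate; tabulate; lookup; updateAt)
open import Data.Vec.Properties using (≡-dec)
open import Data.List as List using (List; []; _∷_; map; concatMap; filter; upTo; foldr; length; _++_)
open import Data.Product using (_×_; _,_)
open import Data.Bool using (Bool; true; false; if_then_else_)
open import Relation.Nullary using (does)
open import Relation.Binary.PropositionalEquality using (_≡_)

-- Formal polynomials over ℤ in n variables x₁,…,xₙ (variable xᵢ is
-- index i-1 : Fin n).  A polynomial is a finite formal sum of terms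
-- (coefficient , exponent vector); two polynomials are equal when all
-- their monomial coefficients agree.

Monomial : ℕ → Set
Monomial n = Vec ℕ n

Poly : ℕ → Set
Poly n = List (ℤ × Monomial n)

coeff : ∀ {n} → Poly n → Monomial n → ℤ
coeff []             m = + 0
coeff ((c , m′) ∷ p) m =
  (if does (≡-dec ℕ._≟_ m′ m) then c else + 0) ℤ.+ coeff p m

infix 4 _≈ₚ_
_≈ₚ_ : ∀ {n} → Poly n → Poly n → Set
p ≈ₚ q = ∀ m → coeff p m ≡ coeff q m

constₚ : ∀ {n} → ℤ → Poly n
constₚ {n} c = (c , replicate n 0) ∷ []

unitMono : ∀ {n} → Fin n → Monomial n
unitMono i = updateAt (replicate _ 0) i (λ _ → 1)

var : ∀ {n} → Fin n → Poly n
var i = (+ 1 , unitMono i) ∷ []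

infixl 6 _+ₚ_ _-ₚ_
infixl 7 _*ₚ_

_+ₚ_ : ∀ {n} → Poly n → Poly n → Poly n
p +ₚ q = p ++ q

negₚ : ∀ {n} → Poly n → Poly n
negₚ = map (λ { (c , m) → (ℤ.- c , m) })

_-ₚ_ : ∀ {n} → Poly n → Poly n → Poly n
p -ₚ q = p +ₚ negₚ q

_*ₚ_ : ∀ {n} → Poly n → Poly n → Poly n
p *ₚ q = concatMap (λ { (c , m) → map (λ { (d , m′) → (c ℤ.* d , zipWith ℕ._+_ m m′) }) q }) p

∂ : ∀ {n} → Fin n → Poly n → Poly n
∂ i = map (λ { (c , m) → (c ℤ.* + lookup m i , updateAt m i (λ k → k ∸ 1)) })

-- substitution φ(x₂,…,x_{k+1}) of a k-variable polynomial into k+2 variables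
embedMid : ∀ {k} → Poly k → Poly (suc (suc k))
embedMid = map (λ { (c , m) → (c , 0 ∷ (m ∷ʳ 0)) })

odd? : ℕ → Bool
odd? a = does (a % 2 ℕ.≟ 1)

oddsUpTo : ℕ → List ℕ
oddsUpTo b = filter (λ a → a % 2 ℕ.≟ 1) (map suc (upTo b))

-- all odd compositions whose total is ≤ b (fuel ≥ b suffices since parts ≥ 1)
oddCompsF : ℕ → ℕ → List (List ℕ)
oddCompsF zero     b = [] ∷ []
oddCompsF (suc f) b = [] ∷ concatMap (λ a → map (a ∷_) (oddCompsF f (b ∸ a))) (oddsUpTo b)

OC≤ : ℕ → List (List ℕ)
OC≤ r = oddCompsF r r

partialSums : List ℕ → List ℕ
partialSums = go 0
  where
  go : ℕ → List ℕ → List ℕ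
  go s []       = []
  go s (a ∷ as) = (s ℕ.+ a) ∷ go (s ℕ.+ a) as

-- σ_r (1-based): σ_r(i) = i/2 (i even), r + (1-i)/2 = r - (i-1)/2 (i odd)
σ : ℕ → ℕ → ℕ
σ r i = if odd? i then r ∸ ((i ∸ 1) / 2) else i / 2

eVar : ∀ {n} → ℕ → Monomial n
eVar {n} j = tabulate (λ i → if does (suc (toℕ i) ℕ.≟ j) then 1 else 0)

xMono : (r : ℕ) → List ℕ → Monomial r
xMono r α = foldr (λ s m → zipWith ℕ._+_ (eVar (σ r s)) m) (replicate r 0) (partialSums α)

sign : List ℕ → ℤ
sign α = -1ℤ ℤ.^ (suc (length α) / 2)

φ : (r : ℕ) → Poly r
φ r = map (λ α → (sign α , xMono r α)) (OC≤ r)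

-- Split OC≤ r by how a composition starts: α = raiseHead β (α empty or α₁ ≥ 3) with β ∈ OC≤ (r-2),
-- α = 1 ∷ 1 ∷ γ with γ ∈ OC≤ (r-2), or α = 1 ∷ raiseHead γ with γ ∈ OC≤ (r-3).  Since
-- σ_r (p + 2) = σ_{r-2} p + 1, σ_r 1 = r and σ_r 2 = 1, the first two classes make up
-- (1 - x₁ x_r) φ_{r-2}(x₂,…,x_{r-1}).  In φ_{r-2} its last variable occurs, linearly, only in the
-- terms of compositions starting with 1, because on partial sums σ_{r-2} p = r-2 forces p = 1;
-- so x_r ∂/∂x_{r-1} turns exactly these terms into the third class.

module Submission where

open import Defs

open import Data.Bool using (true; false; if_then_else_)
open import Data.Bool.Properties using (if-eta)
open import Data.Fin as Fin using (Fin; zero; suc; toℕ; fromℕ; inject₁)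
import Data.Fin.Properties as Fin
open import Data.Integer as ℤ using (ℤ; 0ℤ; 1ℤ; -1ℤ)
import Data.Integer.Properties as ℤ
open import Algebra.Properties.CommutativeSemigroup ℤ.+-commutativeSemigroup using (x∙yz≈y∙xz)
open import Data.List as List using (List; []; _∷_; _++_; map; foldr; length)
import Data.List.Properties as List
open import Data.List.Relation.Binary.Permutation.Propositional as ↭ using (_↭_; module PermutationReasoning)
import Data.List.Relation.Binary.Permutation.Propositional.Properties as ↭
open import Data.List.Relation.Unary.All as All using (All; []; _∷_)
import Data.List.Relation.Unary.All.Properties as All
open import Data.Nat using (ℕ; zero; suc; _+_; _∸_; _≤_; _<_; z≤n; s≤s; _≟_)
import Data.Nat.Properties as ℕ
open import Data.Nat.DivMod using (_/_; _%_; m/n≡1+[m∸n]/n; m/n≤m; m/n<m)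
open import Data.Product using (_×_; _,_; proj₁; proj₂)
open import Data.Vec as Vec using (Vec; _∷ʳ_; zipWith; replicate; lookup; updateAt)
import Data.Vec.Properties as Vec
open import Function using (_∘_)
open import Level using (0ℓ)
open import Relation.Binary.Bundles using (Setoid)
open import Relation.Binary.PropositionalEquality
import Relation.Binary.Reasoning.Setoid as SetoidReasoning
open import Relation.Nullary.Decidable using (does; dec-false)

zipWith-∷ʳ : ∀ {A : Set} {n} (f : A → A → A) (xs ys : Vec A n) x y →
             zipWith f (xs ∷ʳ x) (ys ∷ʳ y) ≡ zipWith f xs ys ∷ʳ f x y
zipWith-∷ʳ f Vec.[]       Vec.[]       x y = refl
zipWith-∷ʳ f (a Vec.∷ xs) (b Vec.∷ ys) x y = cong (f a b Vec.∷_) (zipWith-∷ʳ f xs ys x y)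

replicate-∷ʳ : ∀ {A : Set} n (x : A) → replicate n x ∷ʳ x ≡ replicate (suc n) x
replicate-∷ʳ zero    x = refl
replicate-∷ʳ (suc n) x = cong (x Vec.∷_) (replicate-∷ʳ n x)

lookup-∷ʳ-inject₁ : ∀ {A : Set} {n} (xs : Vec A n) x (i : Fin n) →
                    lookup (xs ∷ʳ x) (inject₁ i) ≡ lookup xs i
lookup-∷ʳ-inject₁ (y Vec.∷ xs) x zero    = refl
lookup-∷ʳ-inject₁ (y Vec.∷ xs) x (suc i) = lookup-∷ʳ-inject₁ xs x i

updateAt-∷ʳ-inject₁ : ∀ {A : Set} {n} (xs : Vec A n) x (i : Fin n) (f : A → A) →
                      updateAt (xs ∷ʳ x) (inject₁ i) f ≡ updateAt xs i f ∷ʳ x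
updateAt-∷ʳ-inject₁ (y Vec.∷ xs) x zero    f = refl
updateAt-∷ʳ-inject₁ (y Vec.∷ xs) x (suc i) f = cong (y Vec.∷_) (updateAt-∷ʳ-inject₁ xs x i f)

infixl 7 _*ₘ_ _*ₜ_

_*ₘ_ : ∀ {n} → Monomial n → Monomial n → Monomial n
_*ₘ_ = zipWith _+_

*ₘ-identityˡ : ∀ {n} (m : Monomial n) → replicate n 0 *ₘ m ≡ m
*ₘ-identityˡ = Vec.zipWith-identityˡ ℕ.+-identityˡ

*ₘ-comm : ∀ {n} (u v : Monomial n) → u *ₘ v ≡ v *ₘ u
*ₘ-comm = Vec.zipWith-comm ℕ.+-comm

*ₘ-assoc : ∀ {n} (u v w : Monomial n) → u *ₘ v *ₘ w ≡ u *ₘ (v *ₘ w)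
*ₘ-assoc = Vec.zipWith-assoc ℕ.+-assoc

embedMono : ∀ {k} → Monomial k → Monomial (2 + k)
embedMono m = 0 Vec.∷ (m ∷ʳ 0)

embedMono-*ₘ : ∀ {k} (u v : Monomial k) → embedMono (u *ₘ v) ≡ embedMono u *ₘ embedMono v
embedMono-*ₘ u v = cong (0 Vec.∷_) (sym (zipWith-∷ʳ _+_ u v 0 0))

embedMono-one : ∀ k → embedMono (replicate k 0) ≡ replicate (2 + k) 0
embedMono-one k = cong (0 Vec.∷_) (replicate-∷ʳ k 0)

eVar-zero : ∀ n → eVar {n} 0 ≡ replicate n 0
eVar-zero zero    = refl
eVar-zero (suc n) = cong (0 Vec.∷_) (eVar-zero n)

eVar-∷ʳ : ∀ {k j} → j ≤ k → eVar {suc k} j ≡ eVar {k} j ∷ʳ 0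
eVar-∷ʳ {k} {zero} _ = trans (eVar-zero (suc k)) (sym (trans (cong (_∷ʳ 0) (eVar-zero k)) (replicate-∷ʳ k 0)))
eVar-∷ʳ {suc k} {suc j} (s≤s j≤k) = cong (_ Vec.∷_) (eVar-∷ʳ j≤k)

embedMono-eVar : ∀ {k j} → 1 ≤ j → j ≤ k → embedMono (eVar {k} j) ≡ eVar (suc j)
embedMono-eVar {k} {suc j} _ j≤k = cong (0 Vec.∷_) (sym (eVar-∷ʳ j≤k))

unitMono≡eVar : ∀ {n} (i : Fin n) → unitMono i ≡ eVar (suc (toℕ i))
unitMono≡eVar {suc n} zero    = cong (1 Vec.∷_) (sym (eVar-zero n))
unitMono≡eVar         (suc i) = cong (0 Vec.∷_) (unitMono≡eVar i)

unitMono-last : ∀ k → unitMono (fromℕ k) ≡ eVar (suc k)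
unitMono-last k = trans (unitMono≡eVar (fromℕ k)) (cong (eVar ∘ suc) (Fin.toℕ-fromℕ k))

lookup-eVar : ∀ {n j} (i : Fin n) → suc (toℕ i) ≢ j → lookup (eVar {n} j) i ≡ 0
lookup-eVar {j = j} i i≢j =
  trans (Vec.lookup∘tabulate _ i) (cong (if_then 1 else 0) (dec-false (suc (toℕ i) ≟ j) i≢j))

lookup-unitMono-*ₘ : ∀ {n} (i : Fin n) (w : Monomial n) → lookup (unitMono i *ₘ w) i ≡ suc (lookup w i)
lookup-unitMono-*ₘ zero    (x Vec.∷ w) = refl
lookup-unitMono-*ₘ (suc i) (x Vec.∷ w) = lookup-unitMono-*ₘ i w

updateAt-unitMono-*ₘ : ∀ {n} (i : Fin n) (w : Monomial n) → updateAt (unitMono i *ₘ w) i (_∸ 1) ≡ w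
updateAt-unitMono-*ₘ zero    (x Vec.∷ w) = cong (x Vec.∷_) (*ₘ-identityˡ w)
updateAt-unitMono-*ₘ (suc i) (x Vec.∷ w) = cong (x Vec.∷_) (updateAt-unitMono-*ₘ i w)

Term : ℕ → Set
Term n = ℤ × Monomial n

-- Termwise forms of _*ₚ_, embedMid and ∂: by refl, ∂ i ≡ map (∂ₜ i), embedMid ≡ map embedTerm
-- and (t ∷ ts) *ₚ p ≡ map (t *ₜ_) p ++ ts *ₚ p.
_*ₜ_ : ∀ {n} → Term n → Term n → Term n
(c , u) *ₜ (d , v) = (c ℤ.* d , u *ₘ v)

embedTerm : ∀ {k} → Term k → Term (2 + k)
embedTerm (c , m) = (c , embedMono m)

∂ₜ : ∀ {n} → Fin n → Term n → Term n
∂ₜ i (c , m) = (c ℤ.* ℤ.+ lookup m i , updateAt m i (_∸ 1))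

∂ₜ-unitMono : ∀ {n} (i : Fin n) c w → lookup w i ≡ 0 → ∂ₜ i (c , unitMono i *ₘ w) ≡ (c , w)
∂ₜ-unitMono i c w wᵢ≡0 = cong₂ _,_
  (trans (cong (λ e → c ℤ.* ℤ.+ e) (trans (lookup-unitMono-*ₘ i w) (cong suc wᵢ≡0))) (ℤ.*-identityʳ c))
  (updateAt-unitMono-*ₘ i w)

∂-embedMid : ∀ {k} (i : Fin k) (p : Poly k) → ∂ (suc (inject₁ i)) (embedMid p) ≡ embedMid (∂ i p)
∂-embedMid i p = begin
  map (∂ₜ (suc (inject₁ i))) (map embedTerm p) ≡⟨ List.map-∘ p ⟨
  map (∂ₜ (suc (inject₁ i)) ∘ embedTerm) p     ≡⟨ List.map-cong commute p ⟩
  map (embedTerm ∘ ∂ₜ i) p                     ≡⟨ List.map-∘ p ⟩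
  map embedTerm (map (∂ₜ i) p)                 ∎
  where
  open ≡-Reasoning
  commute : ∀ t → ∂ₜ (suc (inject₁ i)) (embedTerm t) ≡ embedTerm (∂ₜ i t)
  commute (c , m) = cong₂ _,_ (cong (λ e → c ℤ.* ℤ.+ e) (lookup-∷ʳ-inject₁ m 0 i))
                              (cong (0 Vec.∷_) (updateAt-∷ʳ-inject₁ m 0 i (_∸ 1)))

coeffₜ : ∀ {n} → Term n → Monomial n → ℤ
coeffₜ (c , m′) m = if does (Vec.≡-dec _≟_ m′ m) then c else 0ℤ

coeff-++ : ∀ {n} (p q : Poly n) m → coeff (p ++ q) m ≡ coeff p m ℤ.+ coeff q m
coeff-++ []      q m = sym (ℤ.+-identityˡ (coeff q m))
coeff-++ (t ∷ p) q m =
  trans (cong (λ c → coeffₜ t m ℤ.+ c) (coeff-++ p q m)) (sym (ℤ.+-assoc (coeffₜ t m) (coeff p m) (coeff q m)))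

↭⇒≈ₚ : ∀ {n} {p q : Poly n} → p ↭ q → p ≈ₚ q
↭⇒≈ₚ ↭.refl            m = refl
↭⇒≈ₚ (↭.prep t p↭q)    m = cong (λ c → coeffₜ t m ℤ.+ c) (↭⇒≈ₚ p↭q m)
↭⇒≈ₚ (↭.swap s t p↭q)  m =
  trans (cong (λ c → coeffₜ s m ℤ.+ (coeffₜ t m ℤ.+ c)) (↭⇒≈ₚ p↭q m)) (x∙yz≈y∙xz (coeffₜ s m) (coeffₜ t m) _)
↭⇒≈ₚ (↭.trans p↭q q↭r) m = trans (↭⇒≈ₚ p↭q m) (↭⇒≈ₚ q↭r m)

≈ₚ-dropZeros : ∀ {n} {z : Poly n} → All (λ t → proj₁ t ≡ 0ℤ) z → ∀ p → z ++ p ≈ₚ p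
≈ₚ-dropZeros []                            p m = refl
≈ₚ-dropZeros {z = (_ , m′) ∷ z} (refl ∷ z≡0) p m =
  trans (cong (ℤ._+ coeff (z ++ p) m) (if-eta (does (Vec.≡-dec _≟_ m′ m))))
        (trans (ℤ.+-identityˡ _) (≈ₚ-dropZeros z≡0 p m))

≈ₚ-setoid : ℕ → Setoid 0ℓ 0ℓ
≈ₚ-setoid n = record
  { Carrier       = Poly n
  ; _≈_           = _≈ₚ_
  ; isEquivalence = record
    { refl  = λ _ → refl
    ; sym   = λ p≈q m → sym (p≈q m)
    ; trans = λ p≈q q≈r m → trans (p≈q m) (q≈r m)
    }
  }

InRange : ℕ → ℕ → ℕ → Set
InRange lo hi p = lo ≤ p × p ≤ hi

[2+m]/2≡1+m/2 : ∀ m → (2 + m) / 2 ≡ suc (m / 2)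
[2+m]/2≡1+m/2 m = m/n≡1+[m∸n]/n {2 + m} {2} (s≤s (s≤s z≤n))

σ-inRange : ∀ {k p} → InRange 1 k p → InRange 1 k (σ k p)
σ-inRange {k} {1}           (_ , 1≤k) = 1≤k , ℕ.≤-refl
σ-inRange {k} {suc (suc q)} (_ , p≤k) = inRange (odd? q)
  where
  inRange : ∀ b → InRange 1 k (if b then k ∸ (suc q / 2) else (2 + q) / 2)
  inRange true  = ℕ.m<n⇒0<n∸m (ℕ.<-≤-trans (s≤s (m/n≤m (suc q) 2)) p≤k) , ℕ.m∸n≤m k (suc q / 2)
  inRange false = subst (1 ≤_) (sym ([2+m]/2≡1+m/2 q)) (s≤s z≤n) , ℕ.≤-trans (m/n≤m (2 + q) 2) p≤k

σ-shift : ∀ {k p} → InRange 1 k p → σ (2 + k) (2 + p) ≡ suc (σ k p)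
σ-shift {k} {suc q} (_ , p≤k) = shift (odd? (suc q))
  where
  shift : ∀ b → (if b then (2 + k) ∸ ((2 + q) / 2) else (3 + q) / 2)
                ≡ suc (if b then k ∸ (q / 2) else suc q / 2)
  shift true  = trans (cong ((2 + k) ∸_) ([2+m]/2≡1+m/2 q))
                      (ℕ.+-∸-assoc 1 (ℕ.≤-trans (m/n≤m q 2) (ℕ.≤-trans (ℕ.n≤1+n q) p≤k)))
  shift false = [2+m]/2≡1+m/2 (suc q)

σ≢last : ∀ {k p} → InRange 2 k p → σ k p ≢ k
σ≢last {k} {1}                 (s≤s () , _)
σ≢last {k} {2}                 (_ , 2≤k) = ℕ.<⇒≢ 2≤k
σ≢last {k} {suc (suc (suc q))} (_ , p≤k) = below (odd? (suc q))
  where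
  below : ∀ b → (if b then k ∸ ((2 + q) / 2) else (3 + q) / 2) ≢ k
  below true  = ℕ.<⇒≢ (ℕ.∸-monoʳ-< (subst (0 <_) (sym ([2+m]/2≡1+m/2 q)) (s≤s z≤n))
                                  (ℕ.≤-trans (m/n≤m (2 + q) 2) (ℕ.≤-trans (ℕ.n≤1+n _) p≤k)))
  below false = ℕ.<⇒≢ (ℕ.<-≤-trans (m/n<m (3 + q) 2 (s≤s (s≤s z≤n))) p≤k)

σMonomial : (r : ℕ) → List ℕ → Monomial r
σMonomial r = foldr (λ s m → eVar (σ r s) *ₘ m) (replicate r 0)

embedMono-σMonomial : ∀ {k S} → All (InRange 1 k) S →
                      embedMono (σMonomial k S) ≡ σMonomial (2 + k) (map (2 +_) S)
embedMono-σMonomial {k} []                = embedMono-one k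
embedMono-σMonomial {k} {s ∷ S} (s∈ ∷ S∈) = begin
  embedMono (eVar (σ k s) *ₘ σMonomial k S)                ≡⟨ embedMono-*ₘ _ _ ⟩
  embedMono (eVar (σ k s)) *ₘ embedMono (σMonomial k S)    ≡⟨ cong₂ _*ₘ_ embedMono-eVar-σ (embedMono-σMonomial S∈) ⟩
  eVar (σ (2 + k) (2 + s)) *ₘ σMonomial (2 + k) (map (2 +_) S) ∎
  where
  open ≡-Reasoning
  embedMono-eVar-σ : embedMono (eVar (σ k s)) ≡ eVar (σ (2 + k) (2 + s))
  embedMono-eVar-σ = trans (embedMono-eVar (proj₁ (σ-inRange s∈)) (proj₂ (σ-inRange s∈)))
                           (cong eVar (sym (σ-shift s∈)))

lookup-σMonomial : ∀ {r S} (i : Fin r) → All (λ s → σ r s ≢ suc (toℕ i)) S → lookup (σMonomial r S) i ≡ 0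
lookup-σMonomial {r} i []                      = Vec.lookup-replicate i 0
lookup-σMonomial {r} {s ∷ S} i (σs≢i ∷ σS≢i) = begin
  lookup (eVar (σ r s) *ₘ σMonomial r S) i            ≡⟨ Vec.lookup-zipWith _+_ i (eVar (σ r s)) (σMonomial r S) ⟩
  lookup (eVar (σ r s)) i + lookup (σMonomial r S) i ≡⟨ cong₂ _+_ (lookup-eVar i (σs≢i ∘ sym)) (lookup-σMonomial i σS≢i) ⟩
  0                                                   ∎
  where open ≡-Reasoning

lookup-σMonomial-last : ∀ {n S} → All (InRange 2 (suc n)) S → lookup (σMonomial (suc n) S) (fromℕ n) ≡ 0
lookup-σMonomial-last {n} S∈ =
  lookup-σMonomial (fromℕ n) (All.map (λ s∈ σs≡ → σ≢last s∈ (trans σs≡ (cong suc (Fin.toℕ-fromℕ n)))) S∈)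

partialSums-∷ : ∀ a α → partialSums (a ∷ α) ≡ a ∷ map (a +_) (partialSums α)
partialSums-∷ a α = cong (a ∷_) (partialSums-tail a α)
  where
  -- partialSums accumulates in a local helper; this is that helper started at s
  partialSums-tail : ∀ s α → List.drop 1 (partialSums (s ∷ α)) ≡ map (s +_) (partialSums α)
  partialSums-tail s []      = refl
  partialSums-tail s (c ∷ α) = cong (s + c ∷_) (begin
    List.drop 1 (partialSums (s + c ∷ α))    ≡⟨ partialSums-tail (s + c) α ⟩
    map (s + c +_) (partialSums α)           ≡⟨ List.map-cong (ℕ.+-assoc s c) (partialSums α) ⟩
    map ((s +_) ∘ (c +_)) (partialSums α)    ≡⟨ List.map-∘ (partialSums α) ⟩
    map (s +_) (map (c +_) (partialSums α))  ≡⟨ cong (map (s +_)) (partialSums-tail c α) ⟨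
    map (s +_) (List.drop 1 (partialSums (c ∷ α))) ∎)
    where open ≡-Reasoning

raiseHead : List ℕ → List ℕ
raiseHead []      = []
raiseHead (a ∷ α) = 2 + a ∷ α

partialSums-raiseHead : ∀ α → partialSums (raiseHead α) ≡ map (2 +_) (partialSums α)
partialSums-raiseHead []      = refl
partialSums-raiseHead (a ∷ α) = begin
  partialSums (2 + a ∷ α)                         ≡⟨ partialSums-∷ (2 + a) α ⟩
  2 + a ∷ map ((2 +_) ∘ (a +_)) (partialSums α)   ≡⟨ cong (2 + a ∷_) (List.map-∘ (partialSums α)) ⟩
  map (2 +_) (a ∷ map (a +_) (partialSums α))     ≡⟨ cong (map (2 +_)) (partialSums-∷ a α) ⟨
  map (2 +_) (partialSums (a ∷ α))                ∎
  where open ≡-Reasoning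

sign-raiseHead : ∀ α → sign (raiseHead α) ≡ sign α
sign-raiseHead []      = refl
sign-raiseHead (_ ∷ _) = refl

sign-1∷raiseHead : ∀ α → sign (1 ∷ raiseHead α) ≡ sign (1 ∷ α)
sign-1∷raiseHead []      = refl
sign-1∷raiseHead (_ ∷ _) = refl

sign-1∷1∷ : ∀ α → sign (1 ∷ 1 ∷ α) ≡ -1ℤ ℤ.* sign α
sign-1∷1∷ α = cong (-1ℤ ℤ.^_) ([2+m]/2≡1+m/2 (suc (length α)))

odd-filter-map-2+ : ∀ xs → List.filter (λ a → a % 2 ≟ 1) (map (2 +_) xs)
                         ≡ map (2 +_) (List.filter (λ a → a % 2 ≟ 1) xs)
odd-filter-map-2+ []       = refl
odd-filter-map-2+ (x ∷ xs) with does (x % 2 ≟ 1)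
... | true  = cong (2 + x ∷_) (odd-filter-map-2+ xs)
... | false = odd-filter-map-2+ xs

oddsUpTo-suc : ∀ b → oddsUpTo (suc b) ≡ 1 ∷ map (2 +_) (oddsUpTo (b ∸ 1))
oddsUpTo-suc zero    = refl
oddsUpTo-suc (suc b) = cong (1 ∷_) (begin
  List.filter _ (map suc (List.applyUpTo (2 +_) b))    ≡⟨ cong (List.filter _) (List.map-applyUpTo (2 +_) suc b) ⟩
  List.filter _ (List.applyUpTo (3 +_) b)              ≡⟨ cong (List.filter _) (List.map-upTo (3 +_) b) ⟨
  List.filter _ (map (3 +_) (List.upTo b))             ≡⟨ cong (List.filter _) (List.map-∘ (List.upTo b)) ⟩
  List.filter _ (map (2 +_) (map suc (List.upTo b)))   ≡⟨ odd-filter-map-2+ (map suc (List.upTo b)) ⟩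
  map (2 +_) (oddsUpTo b)                              ∎)
  where open ≡-Reasoning

oddsUpTo-inRange : ∀ b → All (InRange 1 b) (oddsUpTo b)
oddsUpTo-inRange b = All.filter⁺ _ (All.map⁺ (All.applyUpTo⁺₁ _ b (λ i<b → s≤s z≤n , i<b)))

m≤1+n⇒m∸o≤n : ∀ {m n o} → 1 ≤ o → m ≤ suc n → m ∸ o ≤ n
m≤1+n⇒m∸o≤n {m} 1≤o m≤1+n = ℕ.≤-trans (ℕ.∸-monoʳ-≤ m 1≤o) (ℕ.∸-monoˡ-≤ 1 m≤1+n)

oddCompsF-fuel : ∀ {f g b} → b ≤ f → b ≤ g → oddCompsF f b ≡ oddCompsF g b
oddCompsF-fuel {zero}  {zero}  _   _   = refl
oddCompsF-fuel {zero}  {suc g} z≤n _   = refl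
oddCompsF-fuel {suc f} {zero}  _   z≤n = refl
oddCompsF-fuel {suc f} {suc g} {b} b≤f b≤g = cong ([] ∷_) (cong List.concat (List.map-cong-local
  (All.map (λ {a} (1≤a , _) → cong (map (a ∷_)) (oddCompsF-fuel (m≤1+n⇒m∸o≤n 1≤a b≤f) (m≤1+n⇒m∸o≤n 1≤a b≤g)))
           (oddsUpTo-inRange b))))

OC⁺≤ : ℕ → List (List ℕ)
OC⁺≤ b = List.concatMap (λ a → map (a ∷_) (OC≤ (b ∸ a))) (oddsUpTo b)

OC≤-unfold : ∀ b → OC≤ b ≡ [] ∷ OC⁺≤ b
OC≤-unfold zero    = refl
OC≤-unfold (suc b) = cong ([] ∷_) (cong List.concat (List.map-cong-local
  (All.map (λ {a} (1≤a , _) → cong (map (a ∷_)) (oddCompsF-fuel (m≤1+n⇒m∸o≤n 1≤a ℕ.≤-refl) ℕ.≤-refl))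
           (oddsUpTo-inRange (suc b)))))

OC⁺≤-suc : ∀ b → OC⁺≤ (suc b) ≡ map (1 ∷_) (OC≤ b) ++ map raiseHead (OC⁺≤ (b ∸ 1))
OC⁺≤-suc b = begin
  List.concatMap headedBy (oddsUpTo (suc b))                              ≡⟨ cong (List.concatMap headedBy) (oddsUpTo-suc b) ⟩
  map (1 ∷_) (OC≤ b) ++ List.concatMap headedBy (map (2 +_) odds)         ≡⟨ cong (map (1 ∷_) (OC≤ b) ++_) raised ⟩
  map (1 ∷_) (OC≤ b) ++ map raiseHead (List.concatMap headedBy′ odds)     ∎
  where
  open ≡-Reasoning
  odds = oddsUpTo (b ∸ 1)
  headedBy : ℕ → List (List ℕ)
  headedBy a = map (a ∷_) (OC≤ (suc b ∸ a))
  headedBy′ : ℕ → List (List ℕ)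
  headedBy′ a = map (a ∷_) (OC≤ (b ∸ 1 ∸ a))
  raiseHeadedBy : ∀ a → headedBy (2 + a) ≡ map raiseHead (headedBy′ a)
  raiseHeadedBy a = begin
    map (2 + a ∷_) (OC≤ (b ∸ suc a))        ≡⟨ cong (map (2 + a ∷_) ∘ OC≤) (ℕ.∸-+-assoc b 1 a) ⟨
    map (2 + a ∷_) (OC≤ (b ∸ 1 ∸ a))        ≡⟨ List.map-∘ (OC≤ (b ∸ 1 ∸ a)) ⟩
    map raiseHead (headedBy′ a)                ∎
  raised : List.concatMap headedBy (map (2 +_) odds) ≡ map raiseHead (List.concatMap headedBy′ odds)
  raised = begin
    List.concatMap headedBy (map (2 +_) odds)               ≡⟨ List.concatMap-map headedBy (2 +_) odds ⟩
    List.concatMap (headedBy ∘ (2 +_)) odds                 ≡⟨ List.concatMap-cong raiseHeadedBy odds ⟩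
    List.concatMap (map raiseHead ∘ headedBy′) odds         ≡⟨ List.map-concatMap raiseHead headedBy′ odds ⟨
    map raiseHead (List.concatMap headedBy′ odds)           ∎

OC≤-suc : ∀ b → OC≤ (suc b) ↭ map raiseHead (OC≤ (b ∸ 1)) ++ map (1 ∷_) (OC≤ b)
OC≤-suc b = begin
  OC≤ (suc b)                                                       ≡⟨ trans (OC≤-unfold (suc b)) (cong ([] ∷_) (OC⁺≤-suc b)) ⟩
  [] ∷ (map (1 ∷_) (OC≤ b) ++ map raiseHead (OC⁺≤ (b ∸ 1)))         ↭⟨ ↭.prep [] (↭.++-comm (map (1 ∷_) (OC≤ b)) _) ⟩
  map raiseHead ([] ∷ OC⁺≤ (b ∸ 1)) ++ map (1 ∷_) (OC≤ b)           ≡⟨ cong (λ αs → map raiseHead αs ++ map (1 ∷_) (OC≤ b)) (OC≤-unfold (b ∸ 1)) ⟨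
  map raiseHead (OC≤ (b ∸ 1)) ++ map (1 ∷_) (OC≤ b)                 ∎
  where open PermutationReasoning

OC≤-split : ∀ n → OC≤ (3 + n) ↭ (map raiseHead (OC≤ (suc n)) ++ map (λ γ → 1 ∷ 1 ∷ γ) (OC≤ (suc n)))
                                 ++ map (λ γ → 1 ∷ raiseHead γ) (OC≤ n)
OC≤-split n = begin
  OC≤ (2 + k)
    ↭⟨ OC≤-suc (suc k) ⟩
  map raiseHead (OC≤ k) ++ map (1 ∷_) (OC≤ (suc k))
    ↭⟨ ↭.++⁺ˡ (map raiseHead (OC≤ k)) (↭.map⁺ (1 ∷_) (↭.↭-trans (OC≤-suc k) (↭.++-comm (map raiseHead (OC≤ n)) _))) ⟩
  map raiseHead (OC≤ k) ++ map (1 ∷_) (map (1 ∷_) (OC≤ k) ++ map raiseHead (OC≤ n))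
    ≡⟨ cong (map raiseHead (OC≤ k) ++_) (trans (List.map-++ (1 ∷_) (map (1 ∷_) (OC≤ k)) _)
                                               (sym (cong₂ _++_ (List.map-∘ (OC≤ k)) (List.map-∘ (OC≤ n))))) ⟩
  map raiseHead (OC≤ k) ++ (map (λ γ → 1 ∷ 1 ∷ γ) (OC≤ k) ++ map (λ γ → 1 ∷ raiseHead γ) (OC≤ n))
    ↭⟨ ↭.↭-sym (↭.++-assoc (map raiseHead (OC≤ k)) _ _) ⟩
  (map raiseHead (OC≤ k) ++ map (λ γ → 1 ∷ 1 ∷ γ) (OC≤ k)) ++ map (λ γ → 1 ∷ raiseHead γ) (OC≤ n) ∎
  where
  open PermutationReasoning
  k = suc n

PartialSumsIn : ℕ → List ℕ → Set
PartialSumsIn b α = All (InRange 1 b) (partialSums α)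

oddCompsF-partialSumsIn : ∀ f b → All (PartialSumsIn b) (oddCompsF f b)
oddCompsF-partialSumsIn zero    b = [] ∷ []
oddCompsF-partialSumsIn (suc f) b = [] ∷ All.concat⁺ (All.map⁺ (All.map
  (λ {a} a∈ → All.map⁺ (All.map (prepend a∈) (oddCompsF-partialSumsIn f (b ∸ a))))
  (oddsUpTo-inRange b)))
  where
  prepend : ∀ {a α} → InRange 1 b a → PartialSumsIn (b ∸ a) α → PartialSumsIn b (a ∷ α)
  prepend {a} {α} (1≤a , a≤b) α∈ = subst (All (InRange 1 b)) (sym (partialSums-∷ a α))
    ((1≤a , a≤b) ∷ All.map⁺ (All.map (λ (1≤p , p≤b∸a) →
        ℕ.≤-trans 1≤p (ℕ.m≤n+m _ a) , ℕ.≤-trans (ℕ.+-monoʳ-≤ a p≤b∸a) (ℕ.≤-reflexive (ℕ.m+[n∸m]≡n a≤b)))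
      α∈))

OC≤-partialSumsIn : ∀ b → All (PartialSumsIn b) (OC≤ b)
OC≤-partialSumsIn b = oddCompsF-partialSumsIn b b

term : (r : ℕ) → List ℕ → Term r
term r α = (sign α , xMono r α)

term-raiseHead : ∀ {k β} → PartialSumsIn k β →
                 (1ℤ , replicate (2 + k) 0) *ₜ embedTerm (term k β) ≡ term (2 + k) (raiseHead β)
term-raiseHead {k} {β} β∈ = cong₂ _,_
  (trans (ℤ.*-identityˡ (sign β)) (sym (sign-raiseHead β)))
  (begin
    replicate (2 + k) 0 *ₘ embedMono (xMono k β)   ≡⟨ *ₘ-identityˡ _ ⟩
    embedMono (σMonomial k (partialSums β))        ≡⟨ embedMono-σMonomial β∈ ⟩
    σMonomial (2 + k) (map (2 +_) (partialSums β)) ≡⟨ cong (σMonomial (2 + k)) (partialSums-raiseHead β) ⟨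
    xMono (2 + k) (raiseHead β)                    ∎)
  where open ≡-Reasoning

term-1∷1∷ : ∀ {k γ} → PartialSumsIn k γ →
            (-1ℤ , unitMono zero *ₘ unitMono (fromℕ (suc k))) *ₜ embedTerm (term k γ) ≡ term (2 + k) (1 ∷ 1 ∷ γ)
term-1∷1∷ {k} {γ} γ∈ = cong₂ _,_ (sym (sign-1∷1∷ γ)) (begin
  unitMono zero *ₘ unitMono (fromℕ (suc k)) *ₘ embedMono (xMono k γ)
    ≡⟨ cong₂ (λ u v → u *ₘ v *ₘ embedMono (xMono k γ)) (unitMono≡eVar zero) (unitMono-last (suc k)) ⟩
  eVar 1 *ₘ eVar (2 + k) *ₘ embedMono (xMono k γ)
    ≡⟨ cong (_*ₘ embedMono (xMono k γ)) (*ₘ-comm (eVar 1) (eVar (2 + k))) ⟩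
  eVar (2 + k) *ₘ eVar 1 *ₘ embedMono (xMono k γ)
    ≡⟨ *ₘ-assoc (eVar (2 + k)) (eVar 1) _ ⟩
  eVar (2 + k) *ₘ (eVar 1 *ₘ embedMono (σMonomial k (partialSums γ)))
    ≡⟨ cong (λ m → eVar (2 + k) *ₘ (eVar 1 *ₘ m)) (embedMono-σMonomial γ∈) ⟩
  σMonomial (2 + k) (1 ∷ 2 ∷ map (2 +_) (partialSums γ))
    ≡⟨ cong (σMonomial (2 + k)) partialSums-1∷1∷ ⟨
  xMono (2 + k) (1 ∷ 1 ∷ γ) ∎)
  where
  open ≡-Reasoning
  partialSums-1∷1∷ : partialSums (1 ∷ 1 ∷ γ) ≡ 1 ∷ 2 ∷ map (2 +_) (partialSums γ)
  partialSums-1∷1∷ = begin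
    partialSums (1 ∷ 1 ∷ γ)                         ≡⟨ partialSums-∷ 1 (1 ∷ γ) ⟩
    1 ∷ map suc (partialSums (1 ∷ γ))               ≡⟨ cong (λ ps → 1 ∷ map suc ps) (partialSums-∷ 1 γ) ⟩
    1 ∷ 2 ∷ map suc (map suc (partialSums γ))       ≡⟨ cong (λ ps → 1 ∷ 2 ∷ ps) (List.map-∘ (partialSums γ)) ⟨
    1 ∷ 2 ∷ map (2 +_) (partialSums γ)              ∎

∂term-raiseHead : ∀ {n β} → PartialSumsIn (n ∸ 1) β → proj₁ (∂ₜ (fromℕ n) (term (suc n) (raiseHead β))) ≡ 0ℤ
∂term-raiseHead {n} {β} β∈ =
  trans (cong (λ e → sign (raiseHead β) ℤ.* ℤ.+ e) (lookup-σMonomial-last raised∈)) (ℤ.*-zeroʳ (sign (raiseHead β)))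
  where
  bump : ∀ {m p} → InRange 1 (m ∸ 1) p → InRange 2 (suc m) (2 + p)
  bump {zero}  {suc p} (_ , ())
  bump {suc m} {suc p} (_ , p≤m) = s≤s (s≤s z≤n) , s≤s (s≤s p≤m)
  raised∈ : All (InRange 2 (suc n)) (partialSums (raiseHead β))
  raised∈ = subst (All (InRange 2 (suc n))) (sym (partialSums-raiseHead β)) (All.map⁺ (All.map bump β∈))

∂term-1∷ : ∀ {n γ} → PartialSumsIn n γ →
           (1ℤ , unitMono (fromℕ (2 + n))) *ₜ embedTerm (∂ₜ (fromℕ n) (term (suc n) (1 ∷ γ)))
           ≡ term (3 + n) (1 ∷ raiseHead γ)
∂term-1∷ {n} {γ} γ∈ = begin
  (1ℤ , uᵣ) *ₜ embedTerm (∂ₜ (fromℕ n) (term (suc n) (1 ∷ γ)))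
    ≡⟨ cong (λ m → (1ℤ , uᵣ) *ₜ embedTerm (∂ₜ (fromℕ n) (sign (1 ∷ γ) , m))) xMono-1∷ ⟩
  (1ℤ , uᵣ) *ₜ embedTerm (∂ₜ (fromℕ n) (sign (1 ∷ γ) , unitMono (fromℕ n) *ₘ σMonomial (suc n) S))
    ≡⟨ cong (λ t → (1ℤ , uᵣ) *ₜ embedTerm t) (∂ₜ-unitMono (fromℕ n) _ _ (lookup-σMonomial-last S∈)) ⟩
  (1ℤ ℤ.* sign (1 ∷ γ) , uᵣ *ₘ embedMono (σMonomial (suc n) S))
    ≡⟨ cong₂ _,_ (trans (ℤ.*-identityˡ _) (sym (sign-1∷raiseHead γ)))
                 (cong₂ _*ₘ_ (unitMono-last (2 + n)) (embedMono-σMonomial (All.map weaken S∈))) ⟩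
  (sign (1 ∷ raiseHead γ) , σMonomial (3 + n) (1 ∷ map (2 +_) S))
    ≡⟨ cong (λ ps → sign (1 ∷ raiseHead γ) , σMonomial (3 + n) ps) partialSums-1∷raiseHead ⟨
  term (3 + n) (1 ∷ raiseHead γ) ∎
  where
  open ≡-Reasoning
  uᵣ = unitMono (fromℕ (2 + n))
  S = map suc (partialSums γ)
  S∈ : All (InRange 2 (suc n)) S
  S∈ = All.map⁺ (All.map (λ (1≤p , p≤n) → s≤s 1≤p , s≤s p≤n) γ∈)
  weaken : ∀ {s} → InRange 2 (suc n) s → InRange 1 (suc n) s
  weaken (2≤s , s≤k) = ℕ.≤-trans (s≤s z≤n) 2≤s , s≤k
  xMono-1∷ : xMono (suc n) (1 ∷ γ) ≡ unitMono (fromℕ n) *ₘ σMonomial (suc n) S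
  xMono-1∷ = trans (cong (σMonomial (suc n)) (partialSums-∷ 1 γ))
                   (cong (_*ₘ σMonomial (suc n) S) (sym (unitMono-last n)))
  partialSums-1∷raiseHead : partialSums (1 ∷ raiseHead γ) ≡ 1 ∷ map (2 +_) S
  partialSums-1∷raiseHead = begin
    partialSums (1 ∷ raiseHead γ)               ≡⟨ partialSums-∷ 1 (raiseHead γ) ⟩
    1 ∷ map suc (partialSums (raiseHead γ))     ≡⟨ cong (λ ps → 1 ∷ map suc ps) (partialSums-raiseHead γ) ⟩
    1 ∷ map suc (map (2 +_) (partialSums γ))    ≡⟨ cong (1 ∷_) (List.map-∘ (partialSums γ)) ⟨
    1 ∷ map (3 +_) (partialSums γ)              ≡⟨ cong (1 ∷_) (List.map-∘ (partialSums γ)) ⟩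
    1 ∷ map (2 +_) S                            ∎

map-embedMid-cong : ∀ {k r} {c : Term (2 + k) → Term r} {g : List ℕ → Term k} {h : List ℕ → Term r} {αs} →
                    All (λ α → c (embedTerm (g α)) ≡ h α) αs → map c (embedMid (map g αs)) ≡ map h αs
map-embedMid-cong []       = refl
map-embedMid-cong (e ∷ es) = cong₂ _∷_ e (map-embedMid-cong es)

-- With E = embedMid (φ k), the left side computes to map ((1ℤ , 1) *ₜ_) E ++ (map ((-1ℤ , x₁ xᵣ) *ₜ_) E ++ []).
[1-x₁xᵣ]*φ : ∀ k → (constₚ 1ℤ -ₚ var zero *ₚ var (fromℕ (suc k))) *ₚ embedMid (φ k)
                   ≡ map (term (2 + k)) (map raiseHead (OC≤ k)) ++ map (term (2 + k)) (map (λ γ → 1 ∷ 1 ∷ γ) (OC≤ k))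
[1-x₁xᵣ]*φ k = cong₂ _++_
  (trans (map-embedMid-cong (All.map term-raiseHead (OC≤-partialSumsIn k))) (List.map-∘ (OC≤ k)))
  (trans (List.++-identityʳ _)
         (trans (map-embedMid-cong (All.map term-1∷1∷ (OC≤-partialSumsIn k))) (List.map-∘ (OC≤ k))))

xᵣ∂φ : ∀ n → var (fromℕ (2 + n)) *ₚ ∂ (inject₁ (fromℕ (suc n))) (embedMid (φ (suc n)))
             ≈ₚ map (term (3 + n)) (map (λ γ → 1 ∷ raiseHead γ) (OC≤ n))
xᵣ∂φ n = begin
  map xᵣ*_ (∂ (inject₁ (fromℕ k)) (embedMid (φ k))) ++ []
    ≡⟨ List.++-identityʳ _ ⟩
  map xᵣ*_ (∂ (suc (inject₁ (fromℕ n))) (embedMid (φ k)))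
    ≡⟨ cong (map xᵣ*_) (∂-embedMid (fromℕ n) (φ k)) ⟩
  map xᵣ*_ (embedMid (map (∂ₜ (fromℕ n)) (map (term k) (OC≤ k))))
    ≡⟨ cong (map xᵣ*_ ∘ embedMid) (List.map-∘ (OC≤ k)) ⟨
  map xᵣ*_ (embedMid (map (∂ₜ (fromℕ n) ∘ term k) (OC≤ k)))
    ≡⟨ trans (List.map-∘ (OC≤ k)) (cong (map xᵣ*_) (List.map-∘ (OC≤ k))) ⟨
  map D (OC≤ (suc n))
    ≈⟨ ↭⇒≈ₚ (↭.map⁺ D (OC≤-suc n)) ⟩
  map D (map raiseHead (OC≤ (n ∸ 1)) ++ map (1 ∷_) (OC≤ n))
    ≡⟨ List.map-++ D (map raiseHead (OC≤ (n ∸ 1))) _ ⟩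
  map D (map raiseHead (OC≤ (n ∸ 1))) ++ map D (map (1 ∷_) (OC≤ n))
    ≈⟨ ≈ₚ-dropZeros vanishing (map D (map (1 ∷_) (OC≤ n))) ⟩
  map D (map (1 ∷_) (OC≤ n))
    ≡⟨ surviving ⟩
  map (term (3 + n)) (map (λ γ → 1 ∷ raiseHead γ) (OC≤ n)) ∎
  where
  open SetoidReasoning (≈ₚ-setoid (3 + n))
  k = suc n
  xᵣ*_ = (1ℤ , unitMono (fromℕ (2 + n))) *ₜ_
  D : List ℕ → Term (3 + n)
  D = xᵣ*_ ∘ embedTerm ∘ ∂ₜ (fromℕ n) ∘ term k
  vanishing : All (λ t → proj₁ t ≡ 0ℤ) (map D (map raiseHead (OC≤ (n ∸ 1))))
  vanishing = All.map⁺ (All.map⁺ (All.map (cong (ℤ._*_ 1ℤ) ∘ ∂term-raiseHead) (OC≤-partialSumsIn (n ∸ 1))))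
  surviving : map D (map (1 ∷_) (OC≤ n)) ≡ map (term (3 + n)) (map (λ γ → 1 ∷ raiseHead γ) (OC≤ n))
  surviving = trans (sym (List.map-∘ (OC≤ n)))
                    (trans (List.map-cong-local (All.map ∂term-1∷ (OC≤-partialSumsIn n))) (List.map-∘ (OC≤ n)))

φ-recurrence : ∀ n → φ (3 + n) ≈ₚ (constₚ 1ℤ -ₚ var zero *ₚ var (fromℕ (2 + n))) *ₚ embedMid (φ (suc n))
                                 +ₚ var (fromℕ (2 + n)) *ₚ ∂ (inject₁ (fromℕ (suc n))) (embedMid (φ (suc n)))
φ-recurrence n m = begin
  coeff (φ r) m                                    ≡⟨ ↭⇒≈ₚ (↭.map⁺ (term r) (OC≤-split n)) m ⟩
  coeff (map (term r) ((A₁ ++ A₂) ++ A₃)) m        ≡⟨ cong (λ p → coeff p m) map-split ⟩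
  coeff ((X₁ ++ X₂) ++ X₃) m                       ≡⟨ coeff-++ (X₁ ++ X₂) X₃ m ⟩
  coeff (X₁ ++ X₂) m ℤ.+ coeff X₃ m                ≡⟨ cong₂ ℤ._+_ (cong (λ p → coeff p m) ([1-x₁xᵣ]*φ k)) (xᵣ∂φ n m) ⟨
  coeff [1-x₁xᵣ]E m ℤ.+ coeff xᵣ∂E m              ≡⟨ coeff-++ [1-x₁xᵣ]E xᵣ∂E m ⟨
  coeff ([1-x₁xᵣ]E +ₚ xᵣ∂E) m                     ∎
  where
  open ≡-Reasoning
  k = suc n
  r = 3 + n
  A₁ = map raiseHead (OC≤ k)
  A₂ = map (λ γ → 1 ∷ 1 ∷ γ) (OC≤ k)
  A₃ = map (λ γ → 1 ∷ raiseHead γ) (OC≤ n)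
  X₁ = map (term r) A₁
  X₂ = map (term r) A₂
  X₃ = map (term r) A₃
  [1-x₁xᵣ]E = (constₚ 1ℤ -ₚ var zero *ₚ var (fromℕ (2 + n))) *ₚ embedMid (φ k)
  xᵣ∂E = var (fromℕ (2 + n)) *ₚ ∂ (inject₁ (fromℕ k)) (embedMid (φ k))
  map-split : map (term r) ((A₁ ++ A₂) ++ A₃) ≡ (X₁ ++ X₂) ++ X₃
  map-split = trans (List.map-++ (term r) (A₁ ++ A₂) A₃) (cong (_++ X₃) (List.map-++ (term r) A₁ A₂))

-- The statement's notation, imported only here: with +_ in scope the sections (2 +_) above
-- would be ambiguous.
import Data.Nat
open import Data.Integer using (+_)

proposition2p20 :
    (φ 1 ≈ₚ constₚ (+ 1) -ₚ var zero)
    × (φ 2 ≈ₚ constₚ (+ 1) -ₚ var (suc zero) -ₚ var zero *ₚ var (suc zero))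
    × (∀ (n : ℕ) →
         φ (3 Data.Nat.+ n)
           ≈ₚ (constₚ (+ 1) -ₚ var zero *ₚ var (fromℕ (suc (suc n)))) *ₚ embedMid (φ (suc n))
              +ₚ var (fromℕ (suc (suc n))) *ₚ ∂ (inject₁ (fromℕ (suc n))) (embedMid (φ (suc n))))
proposition2p20 = (λ _ → refl) , (λ _ → refl) , φ-recurrence
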